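{- Let $k\ge 5$. For any multigraph $G$ of maximum degree $\Delta$ and matching number less than $k$ such that every two of its edges are incident or joined by an edge, the strong clique number of $G$ satisfies $\omega_2'(G)\le (k-\frac12)\Delta$.
   Context: Multigraphs may have parallel edges; degree counts multiplicity. Two edges are incident if they share an endpoint; they are joined by an edge if some edge of $G$ has one endpoint in common with each. A strong clique is a set of edges every two of which are incident or joined by an edge; $\omega_2'(G)$ is the maximum size of a strong clique. The matching number is the maximum size of a set of pairwise non-incident edges. -}

module Defs where

open import Data.Nat using (ℕ; _⊔_)
open import Data.Fin using (Fin; _≟_)
open import Data.List using (List; map; foldr; allFin)
open import Data.Nat.ListAction using (sum)
open import Data.List.Relation.Unary.AllPairs using (AllPairs)
open import Data.List.Relation.Unary.Unique.Propositional using (Unique)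
open import Data.Product using (_×_; proj₁; proj₂; ∃)
open import Data.Sum using (_⊎_)
open import Data.Bool using (if_then_else_; _∨_)
open import Relation.Nullary using (¬_; ⌊_⌋)
open import Relation.Binary.PropositionalEquality using (_≡_; _≢_)

record Multigraph : Set where
  field
    n     : ℕ
    m     : ℕ
    ends  : Fin m → Fin n × Fin n
    loopless : ∀ e → proj₁ (ends e) ≢ proj₂ (ends e)

module _ (G : Multigraph) where
  open Multigraph G

  Vertex : Set
  Vertex = Fin n

  Edge : Set
  Edge = Fin m

  _∈ₑ_ : Vertex → Edge → Set
  v ∈ₑ e = v ≡ proj₁ (ends e) ⊎ v ≡ proj₂ (ends e)

  -- degree (counts multiplicity of parallel edges)
  degree : Vertex → ℕ
  degree v = sum (map (λ e → if ⌊ v ≟ proj₁ (ends e) ⌋ ∨ ⌊ v ≟ proj₂ (ends e) ⌋ then 1 else 0) (allFin m))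

  maxDegree : ℕ
  maxDegree = foldr _⊔_ 0 (map degree (allFin n))

  Incident : Edge → Edge → Set
  Incident e f = ∃ λ v → v ∈ₑ e × v ∈ₑ f

  JoinedByEdge : Edge → Edge → Set
  JoinedByEdge e f = ∃ λ g → Incident g e × Incident g f

  StronglyAdjacent : Edge → Edge → Set
  StronglyAdjacent e f = Incident e f ⊎ JoinedByEdge e f

  IsMatching : List Edge → Set
  IsMatching M = AllPairs (λ e f → ¬ Incident e f) M

  IsStrongClique : List Edge → Set
  IsStrongClique S = Unique S × AllPairs StronglyAdjacent S

module Submission where

-- Theorem 7.2: let k ≥ 1 (the paper assumes k ≥ 5, which this argument does not use).
--
-- Since a strong clique consists of distinct edges, it suffices to bound the number of
-- edges: 2·e(G) ≤ (2j + 1)Δ whenever every matching has at most j edges.  This is proved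
-- for all induced subgraphs G[X] by induction on j (`edge-bound`).  If some vertex v is
-- covered by every maximum matching, deleting it lowers the matching number and costs at
-- most deg v ≤ Δ edges.  Otherwise Gallai's lemma says that a maximum matching M cannot
-- miss two vertices joined by a walk; strong adjacency joins any two non-isolated vertices
-- by a walk, so M misses at most one of them, and summing degrees gives 2·e ≤ (2|M| + 1)Δ.
-- The case distinctions are classical, so the bound is obtained under double negation and
-- recovered because it is decidable.

open import Defs
open import Data.Bool using (Bool; true; false; not; _∧_; _∨_; _xor_; if_then_else_)
open import Data.Bool.Properties using (∧-conicalˡ; ∧-conicalʳ; ∧-zeroʳ; xor-comm) renaming (_≟_ to _≟ᵇ_)
open import Data.Fin using (Fin; _≟_)
open import Data.Fin.Properties using (any?)
open import Data.List using (List; []; _∷_; map; foldr; filter; allFin; length)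
open import Data.List.Membership.Propositional using (_∈_)
open import Data.List.Membership.Propositional.Properties using (∈-allFin)
open import Data.List.Properties using (length-tabulate)
open import Data.List.Relation.Unary.All as All using (All; []; _∷_)
open import Data.List.Relation.Unary.AllPairs using (AllPairs; []; _∷_)
import Data.List.Relation.Unary.AllPairs.Properties as AllPairs
open import Data.List.Relation.Unary.All.Properties using (all-filter)
open import Data.List.Relation.Unary.Any using (here; there)
open import Data.List.Relation.Unary.Unique.Propositional using (Unique)
open import Data.List.Relation.Unary.Unique.Propositional.Properties using (allFin⁺)
open import Data.Nat using (ℕ; zero; suc; _+_; _*_; _∸_; _≤_; _<_; _⊔_; z≤n; s≤s; _≤?_)
open import Data.Nat.ListAction using (sum)
import Data.Nat as ℕ
open import Data.Nat.Properties hiding (_≟_)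
open import Data.Nat.Tactic.RingSolver using (solve-∀)
open import Algebra.Properties.CommutativeSemigroup +-commutativeSemigroup using (interchange)
open import Data.Product using (_×_; _,_; proj₁; proj₂; ∃; Σ-syntax)
open import Data.Sum using (_⊎_; inj₁; inj₂)
open import Data.Empty using (⊥; ⊥-elim)
open import Relation.Nullary using (¬_; ⌊_⌋; Dec; does; yes; no; contradiction)
open import Relation.Nullary.Decidable using (dec-true; dec-false; ¬¬-excluded-middle; decidable-stable)
open import Function using (_∘_)
open import Relation.Binary.PropositionalEquality
  using (_≡_; _≢_; refl; sym; trans; cong; cong₂; subst; module ≡-Reasoning)

χ : Bool → ℕ
χ b = if b then 1 else 0

χ≤1 : ∀ b → χ b ≤ 1
χ≤1 true  = s≤s z≤n
χ≤1 false = z≤n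

χ-true : ∀ {b} → 1 ≤ χ b → b ≡ true
χ-true {true} _ = refl

-- case split on a boolean without abstracting it in the goal
true-or-false : ∀ b → b ≡ true ⊎ b ≡ false
true-or-false true  = inj₁ refl
true-or-false false = inj₂ refl

≡-or-xor : ∀ a b → a ≡ b ⊎ a xor b ≡ true
≡-or-xor true  true  = inj₁ refl
≡-or-xor false false = inj₁ refl
≡-or-xor true  false = inj₂ refl
≡-or-xor false true  = inj₂ refl

xor⇒∧-false : ∀ a b → a xor b ≡ true → a ∧ b ≡ false
xor⇒∧-false true  false _ = refl
xor⇒∧-false false _     _ = refl

χ-mono : ∀ {a b} → (a ≡ true → b ≡ true) → χ a ≤ χ b
χ-mono {false} _   = z≤n
χ-mono {true}  a⇒b rewrite a⇒b refl = ≤-refl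

Σl : {A : Set} → (A → ℕ) → List A → ℕ
Σl f xs = sum (map f xs)

module _ {A : Set} where

  Σl-cong : ∀ {f g : A → ℕ} xs → (∀ x → f x ≡ g x) → Σl f xs ≡ Σl g xs
  Σl-cong []       f≡g = refl
  Σl-cong (x ∷ xs) f≡g = cong₂ _+_ (f≡g x) (Σl-cong xs f≡g)

  Σl-mono : ∀ {f g : A → ℕ} xs → (∀ x → f x ≤ g x) → Σl f xs ≤ Σl g xs
  Σl-mono []       f≤g = z≤n
  Σl-mono (x ∷ xs) f≤g = +-mono-≤ (f≤g x) (Σl-mono xs f≤g)

  Σl-+ : ∀ (f g : A → ℕ) xs → Σl (λ x → f x + g x) xs ≡ Σl f xs + Σl g xs
  Σl-+ f g []       = refl
  Σl-+ f g (x ∷ xs) rewrite Σl-+ f g xs = interchange (f x) (g x) (Σl f xs) (Σl g xs)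

  Σl-* : ∀ c (f : A → ℕ) xs → Σl (λ x → c * f x) xs ≡ c * Σl f xs
  Σl-* c f []       = sym (*-zeroʳ c)
  Σl-* c f (x ∷ xs) rewrite Σl-* c f xs = sym (*-distribˡ-+ c (f x) (Σl f xs))

  Σl-vanish : ∀ {f : A → ℕ} {xs} → All (λ x → f x ≡ 0) xs → Σl f xs ≡ 0
  Σl-vanish []             = refl
  Σl-vanish (fx≡0 ∷ rest) rewrite fx≡0 = Σl-vanish rest

  Σl-one : ∀ (xs : List A) → Σl (λ _ → 1) xs ≡ length xs
  Σl-one []       = refl
  Σl-one (x ∷ xs) = cong suc (Σl-one xs)

  Σl-member : ∀ (f : A → ℕ) {x xs} → x ∈ xs → f x ≤ Σl f xs
  Σl-member f {xs = y ∷ ys} (here refl) = m≤m+n (f y) (Σl f ys)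
  Σl-member f {xs = y ∷ ys} (there x∈ys) = ≤-trans (Σl-member f x∈ys) (m≤n+m (Σl f ys) (f y))

  Σl-positive : ∀ (f : A → ℕ) xs → 1 ≤ Σl f xs → ∃ λ x → 1 ≤ f x
  Σl-positive f (x ∷ xs) pos with f x in fx
  ... | zero  = Σl-positive f xs pos
  ... | suc _ = x , subst (1 ≤_) (sym fx) (s≤s z≤n)

  Σl-atMostOne : ∀ {R : A → A → Set} (f : A → ℕ) {xs} → AllPairs R xs → (∀ x → f x ≤ 1) →
                 (∀ x y → R x y → 1 ≤ f x → 1 ≤ f y → ⊥) → Σl f xs ≤ 1
  Σl-atMostOne f [] f≤1 exclusive = z≤n
  Σl-atMostOne {R} f {x ∷ xs} (Rx ∷ Rxs) f≤1 exclusive with 1 ≤? f x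
  ... | no  fx≱1 = ≤-trans (+-monoˡ-≤ (Σl f xs) (≤-pred (≰⇒> fx≱1))) (Σl-atMostOne f Rxs f≤1 exclusive)
  ... | yes fx≥1 = subst (λ rest → f x + rest ≤ 1) (sym (Σl-vanish (All.map othersVanish Rx)))
                                (≤-trans (≤-reflexive (+-identityʳ (f x))) (f≤1 x))
    where
    othersVanish : ∀ {y} → R x y → f y ≡ 0
    othersVanish Rxy = n≤0⇒n≡0 (≤-pred (≰⇒> (exclusive x _ Rxy fx≥1)))

Σl-swap : ∀ {A B : Set} (f : A → B → ℕ) xs ys →
          Σl (λ x → Σl (f x) ys) xs ≡ Σl (λ y → Σl (λ x → f x y) xs) ys
Σl-swap f []       ys = sym (Σl-vanish {xs = ys} (All.tabulate (λ _ → refl)))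
Σl-swap f (x ∷ xs) ys rewrite Σl-swap f xs ys = sym (Σl-+ (f x) (λ y → Σl (λ x′ → f x′ y) xs) ys)

∑ : ∀ {k} → (Fin k → ℕ) → ℕ
∑ {k} f = Σl f (allFin k)

∑-vanish : ∀ {k} {f : Fin k → ℕ} → (∀ i → f i ≡ 0) → ∑ f ≡ 0
∑-vanish {k} f≡0 = Σl-vanish {xs = allFin k} (All.tabulate (λ {i} _ → f≡0 i))

δ : ∀ {k} → Fin k → Fin k → ℕ
δ i a = χ (does (i ≟ a))

δ-self : ∀ {k} (a : Fin k) → δ a a ≡ 1
δ-self a = cong χ (dec-true (a ≟ a) refl)

δ-other : ∀ {k} (i a : Fin k) → i ≢ a → δ i a ≡ 0
δ-other i a i≢a = cong χ (dec-false (i ≟ a) i≢a)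

δ-positive : ∀ {k} (i a : Fin k) → 1 ≤ δ i a → i ≡ a
δ-positive i a pos with i ≟ a
... | yes i≡a = i≡a

∑-δ : ∀ {k} (a : Fin k) → ∑ (λ i → δ i a) ≡ 1
∑-δ {k} a = ≤-antisym atMostOne (subst (_≤ ∑ (λ i → δ i a)) (δ-self a) (Σl-member (λ i → δ i a) (∈-allFin a)))
  where
  atMostOne : ∑ (λ i → δ i a) ≤ 1
  atMostOne = Σl-atMostOne (λ i → δ i a) (allFin⁺ k) (λ i → χ≤1 _)
                (λ i i′ i≢i′ i≡a i′≡a → i≢i′ (trans (δ-positive i a i≡a) (sym (δ-positive i′ a i′≡a))))

∑-one : ∀ k → ∑ {k} (λ _ → 1) ≡ k
∑-one k = trans (Σl-one (allFin k)) (length-tabulate (λ i → i))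

∑-≤card : ∀ {k} (f : Fin k → ℕ) → (∀ i → f i ≤ 1) → ∑ f ≤ k
∑-≤card {k} f f≤1 = subst (∑ f ≤_) (∑-one k) (Σl-mono (allFin k) f≤1)

-- A duplicate-free list over `Fin k` has at most `k` entries: counting the pairs
-- (entry, element) with δ = 1 in both orders.
distinct-length : ∀ {k} (xs : List (Fin k)) → Unique xs → length xs ≤ k
distinct-length {k} xs distinct = begin
  length xs                              ≡⟨ sym (Σl-one xs) ⟩
  Σl (λ _ → 1) xs                        ≡⟨ sym (Σl-cong xs ∑-δ) ⟩
  Σl (λ x → ∑ (λ i → δ i x)) xs          ≡⟨ Σl-swap (λ x i → δ i x) xs (allFin k) ⟩
  ∑ (λ i → Σl (δ i) xs)                  ≤⟨ ∑-≤card (λ i → Σl (δ i) xs) occursAtMostOnce ⟩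
  k                                      ∎
  where
  open ≤-Reasoning
  occursAtMostOnce : ∀ i → Σl (δ i) xs ≤ 1
  occursAtMostOnce i = Σl-atMostOne (δ i) distinct (λ _ → χ≤1 _)
                         (λ x x′ x≢x′ i≡x i≡x′ → x≢x′ (trans (sym (δ-positive i x i≡x)) (δ-positive i x′ i≡x′)))

length-filter-χ : ∀ {A : Set} (p : A → Bool) xs → length (filter (λ x → p x ≟ᵇ true) xs) ≡ Σl (λ x → χ (p x)) xs
length-filter-χ p []       = refl
length-filter-χ p (x ∷ xs) with p x
... | true  = cong suc (length-filter-χ p xs)
... | false = length-filter-χ p xs

AllPairs-restrict : ∀ {A : Set} {Q : A → Set} {R S : A → A → Set} →
                    (∀ {x y} → Q x → Q y → R x y → S x y) → ∀ {xs} → All Q xs → AllPairs R xs → AllPairs S xs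
AllPairs-restrict R⇒S []         []         = []
AllPairs-restrict R⇒S (Qx ∷ Qxs) (Rx ∷ Rxs) =
  All.zipWith (λ (Qy , Rxy) → R⇒S Qx Qy Rxy) (Qxs , Rx) ∷ AllPairs-restrict R⇒S Qxs Rxs

≤-foldr-⊔ : ∀ {A : Set} (f : A → ℕ) {x xs} → x ∈ xs → f x ≤ foldr _⊔_ 0 (map f xs)
≤-foldr-⊔ f {xs = y ∷ ys} (here refl)  = m≤m⊔n (f y) _
≤-foldr-⊔ f {xs = y ∷ ys} (there x∈ys) = m≤n⇒m≤o⊔n (f y) (≤-foldr-⊔ f x∈ys)

module Graph (G : Multigraph) where
  open Multigraph G

  src tgt : Fin m → Fin n
  src e = proj₁ (ends e)
  tgt e = proj₂ (ends e)

  _∈ᵇ_ : Fin n → Fin m → Bool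
  x ∈ᵇ e = ⌊ x ≟ src e ⌋ ∨ ⌊ x ≟ tgt e ⌋

  ∈ᵇ-endpoint : ∀ x e → x ∈ᵇ e ≡ true → x ≡ src e ⊎ x ≡ tgt e
  ∈ᵇ-endpoint x e x∈e with x ≟ src e | x ≟ tgt e
  ... | yes x≡s | _       = inj₁ x≡s
  ... | no  _   | yes x≡t = inj₂ x≡t

  src-∈ᵇ : ∀ e → src e ∈ᵇ e ≡ true
  src-∈ᵇ e with src e ≟ src e
  ... | yes _   = refl
  ... | no  s≢s = ⊥-elim (s≢s refl)

  tgt-∈ᵇ : ∀ e → tgt e ∈ᵇ e ≡ true
  tgt-∈ᵇ e with tgt e ≟ src e | tgt e ≟ tgt e
  ... | yes _ | _       = refl
  ... | no  _ | yes _   = refl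
  ... | no  _ | no  t≢t = ⊥-elim (t≢t refl)

  ∈ₑ⇒∈ᵇ : ∀ x e → _∈ₑ_ G x e → x ∈ᵇ e ≡ true
  ∈ₑ⇒∈ᵇ x e (inj₁ refl) = src-∈ᵇ e
  ∈ₑ⇒∈ᵇ x e (inj₂ refl) = tgt-∈ᵇ e

  only-two-endpoints : ∀ {u w} x e → u ∈ᵇ e ≡ true → w ∈ᵇ e ≡ true → u ≢ w → x ∈ᵇ e ≡ true → x ≡ u ⊎ x ≡ w
  only-two-endpoints {u} {w} x e u∈e w∈e u≢w x∈e
    with ∈ᵇ-endpoint u e u∈e | ∈ᵇ-endpoint w e w∈e | ∈ᵇ-endpoint x e x∈e
  ... | inj₁ u≡s | inj₁ w≡s | _        = ⊥-elim (u≢w (trans u≡s (sym w≡s)))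
  ... | inj₂ u≡t | inj₂ w≡t | _        = ⊥-elim (u≢w (trans u≡t (sym w≡t)))
  ... | inj₁ u≡s | inj₂ _   | inj₁ x≡s = inj₁ (trans x≡s (sym u≡s))
  ... | inj₁ _   | inj₂ w≡t | inj₂ x≡t = inj₂ (trans x≡t (sym w≡t))
  ... | inj₂ _   | inj₁ w≡s | inj₁ x≡s = inj₂ (trans x≡s (sym w≡s))
  ... | inj₂ u≡t | inj₁ _   | inj₂ x≡t = inj₁ (trans x≡t (sym u≡t))

  -- Since edges are not loops, the incidence indicator splits over the two endpoints ...
  χ-∈ᵇ : ∀ x e → χ (x ∈ᵇ e) ≡ δ x (src e) + δ x (tgt e)
  χ-∈ᵇ x e with x ≟ src e | x ≟ tgt e
  ... | yes x≡s | yes x≡t = ⊥-elim (loopless e (trans (sym x≡s) x≡t))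
  ... | yes _   | no  _   = refl
  ... | no  _   | yes _   = refl
  ... | no  _   | no  _   = refl

  ∑-endpoints : ∀ e → ∑ (λ x → χ (x ∈ᵇ e)) ≡ 2
  ∑-endpoints e = begin
    ∑ (λ x → χ (x ∈ᵇ e))                    ≡⟨ Σl-cong (allFin n) (λ x → χ-∈ᵇ x e) ⟩
    ∑ (λ x → δ x (src e) + δ x (tgt e))     ≡⟨ Σl-+ (λ x → δ x (src e)) (λ x → δ x (tgt e)) (allFin n) ⟩
    ∑ (λ x → δ x (src e)) + ∑ (λ x → δ x (tgt e)) ≡⟨ cong₂ _+_ (∑-δ (src e)) (∑-δ (tgt e)) ⟩
    2                                       ∎
    where open ≡-Reasoning

  VSet ESet : Set
  VSet = Fin n → Bool
  ESet = Fin m → Bool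

  size : ESet → ℕ
  size P = ∑ (λ e → χ (P e))

  vsize : VSet → ℕ
  vsize S = ∑ (λ x → χ (S x))

  -- The edges with both ends in T, i.e. the edges of the subgraph induced by T.
  inside : VSet → ESet
  inside T e = T (src e) ∧ T (tgt e)

  inside-∈ᵇ : ∀ T e x → inside T e ≡ true → x ∈ᵇ e ≡ true → T x ≡ true
  inside-∈ᵇ T e x e⊆T x∈e with ∈ᵇ-endpoint x e x∈e
  ... | inj₁ refl = ∧-conicalˡ (T (src e)) _ e⊆T
  ... | inj₂ refl = ∧-conicalʳ (T (src e)) _ e⊆T

  inside-intro : ∀ {T e u w} → u ∈ᵇ e ≡ true → w ∈ᵇ e ≡ true → u ≢ w → T u ≡ true → T w ≡ true → inside T e ≡ true
  inside-intro {T} {e} u∈e w∈e u≢w Tu Tw = cong₂ _∧_ (inT (src-∈ᵇ e)) (inT (tgt-∈ᵇ e))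
    where
    inT : ∀ {x} → x ∈ᵇ e ≡ true → T x ≡ true
    inT {x} x∈e with only-two-endpoints x e u∈e w∈e u≢w x∈e
    ... | inj₁ refl = Tu
    ... | inj₂ refl = Tw

  inside-mono : ∀ {S T} → (∀ x → S x ≡ true → T x ≡ true) → ∀ e → inside S e ≡ true → inside T e ≡ true
  inside-mono {S} S⊆T e e⊆S =
    cong₂ _∧_ (S⊆T (src e) (∧-conicalˡ (S (src e)) _ e⊆S)) (S⊆T (tgt e) (∧-conicalʳ (S (src e)) _ e⊆S))

  deg : ESet → Fin n → ℕ
  deg P x = ∑ (λ e → χ (P e ∧ x ∈ᵇ e))

  handshake : ∀ P → ∑ (deg P) ≡ 2 * size P
  handshake P = begin
    ∑ (λ x → ∑ (λ e → χ (P e ∧ x ∈ᵇ e)))   ≡⟨ Σl-swap (λ x e → χ (P e ∧ x ∈ᵇ e)) (allFin n) (allFin m) ⟩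
    ∑ (λ e → ∑ (λ x → χ (P e ∧ x ∈ᵇ e)))   ≡⟨ Σl-cong (allFin m) perEdge ⟩
    ∑ (λ e → 2 * χ (P e))                  ≡⟨ Σl-* 2 (λ e → χ (P e)) (allFin m) ⟩
    2 * size P                             ∎
    where
    open ≡-Reasoning
    perEdge : ∀ e → ∑ (λ x → χ (P e ∧ x ∈ᵇ e)) ≡ 2 * χ (P e)
    perEdge e with P e
    ... | true  = ∑-endpoints e
    ... | false = ∑-vanish {f = λ x → χ (false ∧ x ∈ᵇ e)} (λ _ → refl)

  record Matching (X : VSet) (P : ESet) : Set where
    field
      within   : ∀ e → P e ≡ true → inside X e ≡ true
      disjoint : ∀ e f x → P e ≡ true → P f ≡ true → x ∈ᵇ e ≡ true → x ∈ᵇ f ≡ true → e ≡ f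
  open Matching public

  Exposed : ESet → Fin n → Set
  Exposed P x = ∀ e → P e ≡ true → x ∈ᵇ e ≡ true → ⊥

  matching-deg≤1 : ∀ {X P} → Matching X P → ∀ x → deg P x ≤ 1
  matching-deg≤1 {X} {P} mP x = Σl-atMostOne (λ e → χ (P e ∧ x ∈ᵇ e)) (allFin⁺ m) (λ _ → χ≤1 _) sharesNoEndpoint
    where
    sharesNoEndpoint : ∀ e f → e ≢ f → 1 ≤ χ (P e ∧ x ∈ᵇ e) → 1 ≤ χ (P f ∧ x ∈ᵇ f) → ⊥
    sharesNoEndpoint e f e≢f xe xf = e≢f (disjoint mP e f x
      (∧-conicalˡ (P e) _ (χ-true xe)) (∧-conicalˡ (P f) _ (χ-true xf))
      (∧-conicalʳ (P e) _ (χ-true xe)) (∧-conicalʳ (P f) _ (χ-true xf)))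

  exposed⇒deg≡0 : ∀ P x → Exposed P x → deg P x ≡ 0
  exposed⇒deg≡0 P x exposed = ∑-vanish noEdge
    where
    noEdge : ∀ e → χ (P e ∧ x ∈ᵇ e) ≡ 0
    noEdge e with P e in Pe | x ∈ᵇ e in x∈e
    ... | true  | true  = ⊥-elim (exposed e Pe x∈e)
    ... | true  | false = refl
    ... | false | _     = refl

  deg≡0⇒exposed : ∀ P x → deg P x ≡ 0 → Exposed P x
  deg≡0⇒exposed P x deg≡0 e Pe x∈e = contradiction (begin
    1                      ≡⟨ cong χ (cong₂ _∧_ Pe x∈e) ⟨
    χ (P e ∧ x ∈ᵇ e)       ≤⟨ Σl-member (λ f → χ (P f ∧ x ∈ᵇ f)) (∈-allFin e) ⟩
    deg P x                ≡⟨ deg≡0 ⟩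
    0                      ∎) λ ()
    where open ≤-Reasoning

  augment : ∀ {X M} → Matching X M → ∀ e {u w} → inside X e ≡ true →
            u ∈ᵇ e ≡ true → w ∈ᵇ e ≡ true → u ≢ w → Exposed M u → Exposed M w →
            Σ[ P ∈ ESet ] (Matching X P × size P ≡ suc (size M))
  augment {X} {M} mM e {u} {w} e⊆X u∈e w∈e u≢w Mu Mw = P , record { within = within′ ; disjoint = disjoint′ } , sizeP
    where
    P : ESet
    P f = does (f ≟ e) ∨ M f
    endsExposed : ∀ x → x ∈ᵇ e ≡ true → Exposed M x
    endsExposed x x∈e with only-two-endpoints x e u∈e w∈e u≢w x∈e
    ... | inj₁ refl = Mu
    ... | inj₂ refl = Mw
    e∉M : M e ≡ false
    e∉M with M e in Me
    ... | true  = ⊥-elim (endsExposed (src e) (src-∈ᵇ e) e Me (src-∈ᵇ e))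
    ... | false = refl
    within′ : ∀ f → P f ≡ true → inside X f ≡ true
    within′ f Pf with f ≟ e
    ... | yes refl = e⊆X
    ... | no  _    = within mM f Pf
    disjoint′ : ∀ f g x → P f ≡ true → P g ≡ true → x ∈ᵇ f ≡ true → x ∈ᵇ g ≡ true → f ≡ g
    disjoint′ f g x Pf Pg x∈f x∈g with f ≟ e | g ≟ e
    ... | yes f≡e | yes g≡e = trans f≡e (sym g≡e)
    ... | yes refl | no _   = ⊥-elim (endsExposed x x∈f g Pg x∈g)
    ... | no _ | yes refl   = ⊥-elim (endsExposed x x∈g f Pf x∈f)
    ... | no _ | no _       = disjoint mM f g x Pf Pg x∈f x∈g
    χP : ∀ f → χ (P f) ≡ δ f e + χ (M f)
    χP f with f ≟ e
    ... | yes refl rewrite e∉M = refl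
    ... | no  _    = refl
    sizeP : size P ≡ suc (size M)
    sizeP = begin
      size P                             ≡⟨ Σl-cong (allFin m) χP ⟩
      ∑ (λ f → δ f e + χ (M f))          ≡⟨ Σl-+ (λ f → δ f e) (λ f → χ (M f)) (allFin m) ⟩
      ∑ (λ f → δ f e) + size M           ≡⟨ cong (_+ size M) (∑-δ e) ⟩
      suc (size M)                       ∎
      where open ≡-Reasoning

  _∩_ _△_ : ESet → ESet → ESet
  (A ∩ B) e = A e ∧ B e
  (A △ B) e = A e xor B e

  restrict : ESet → VSet → ESet
  restrict H T e = H e ∧ inside T e

  -- T is a union of components of H: no edge of H has exactly one endpoint in T.
  ClosedUnder : ESet → VSet → Set
  ClosedUnder H T = ∀ e → H e ≡ true → T (src e) ≡ T (tgt e)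

  -- Exchange along T: inside T, the edges of A △ B swap membership in A.
  exchange : ESet → ESet → VSet → ESet
  exchange A B T = A △ restrict (A △ B) T

  exchange-χ : ∀ a b c → χ (a xor ((a xor b) ∧ c)) + χ (a ∧ ((a xor b) ∧ c)) ≡ χ a + χ (b ∧ ((a xor b) ∧ c))
  exchange-χ true  true  c     = refl
  exchange-χ true  false true  = refl
  exchange-χ true  false false = refl
  exchange-χ false true  true  = refl
  exchange-χ false true  false = refl
  exchange-χ false false c     = refl

  module Exchange {X A B} (mA : Matching X A) (mB : Matching X B) (T : VSet) (closed : ClosedUnder (A △ B) T) where

    D A′ : ESet
    D  = restrict (A △ B) T
    A′ = exchange A B T

    classify : ∀ e → A′ e ≡ true → (A e ≡ true × D e ≡ false) ⊎ (B e ≡ true × A e ≡ false × inside T e ≡ true)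
    classify e A′e with A e | B e | inside T e
    ... | true  | true  | _     = inj₁ (refl , refl)
    ... | true  | false | false = inj₁ (refl , refl)
    ... | false | true  | true  = inj₂ (refl , refl , refl)

    D-intro : ∀ {e} x → (A △ B) e ≡ true → x ∈ᵇ e ≡ true → T x ≡ true → D e ≡ true
    D-intro {e} x AB x∈e Tx with ∈ᵇ-endpoint x e x∈e | closed e AB
    ... | inj₁ refl | s≡t rewrite AB | Tx | sym s≡t = refl
    ... | inj₂ refl | s≡t rewrite AB | Tx | s≡t     = refl

    kept-new-disjoint : ∀ e f x → A e ≡ true → D e ≡ false → B f ≡ true → A f ≡ false → inside T f ≡ true →
                        x ∈ᵇ e ≡ true → x ∈ᵇ f ≡ true → ⊥
    kept-new-disjoint e f x Ae De Bf Af f⊆T x∈e x∈f with true-or-false (B e)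
    ... | inj₁ Be = contradiction (trans (sym Ae) (trans (cong A (disjoint mB e f x Be Bf x∈e x∈f)) Af)) λ ()
    ... | inj₂ Be = contradiction (trans (sym De) (D-intro x (cong₂ _xor_ Ae Be) x∈e (inside-∈ᵇ T f x f⊆T x∈f))) λ ()

    exchange-matching : Matching X A′
    exchange-matching = record { within = within′ ; disjoint = disjoint′ }
      where
      within′ : ∀ e → A′ e ≡ true → inside X e ≡ true
      within′ e A′e with classify e A′e
      ... | inj₁ (Ae , _) = within mA e Ae
      ... | inj₂ (Be , _) = within mB e Be
      disjoint′ : ∀ e f x → A′ e ≡ true → A′ f ≡ true → x ∈ᵇ e ≡ true → x ∈ᵇ f ≡ true → e ≡ f
      disjoint′ e f x A′e A′f x∈e x∈f with classify e A′e | classify f A′f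
      ... | inj₁ (Ae , _) | inj₁ (Af , _) = disjoint mA e f x Ae Af x∈e x∈f
      ... | inj₂ (Be , _) | inj₂ (Bf , _) = disjoint mB e f x Be Bf x∈e x∈f
      ... | inj₁ (Ae , De) | inj₂ (Bf , Af , f⊆T) = ⊥-elim (kept-new-disjoint e f x Ae De Bf Af f⊆T x∈e x∈f)
      ... | inj₂ (Be , Ae , e⊆T) | inj₁ (Af , Df) = ⊥-elim (kept-new-disjoint f e x Af Df Be Ae e⊆T x∈f x∈e)

    exchange-size : size A′ + size (A ∩ D) ≡ size A + size (B ∩ D)
    exchange-size = begin
      size A′ + size (A ∩ D)              ≡⟨ Σl-+ (λ e → χ (A′ e)) (λ e → χ ((A ∩ D) e)) (allFin m) ⟨
      ∑ (λ e → χ (A′ e) + χ ((A ∩ D) e))  ≡⟨ Σl-cong (allFin m) (λ e → exchange-χ (A e) (B e) (inside T e)) ⟩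
      ∑ (λ e → χ (A e) + χ ((B ∩ D) e))   ≡⟨ Σl-+ (λ e → χ (A e)) (λ e → χ ((B ∩ D) e)) (allFin m) ⟩
      size A + size (B ∩ D)               ∎
      where open ≡-Reasoning

    exposed-inside : ∀ {x} → Exposed B x → T x ≡ true → Exposed A′ x
    exposed-inside {x} Bx Tx e A′e x∈e with classify e A′e
    ... | inj₂ (Be , _) = Bx e Be x∈e
    ... | inj₁ (Ae , De) with true-or-false (B e)
    ...   | inj₁ Be = Bx e Be x∈e
    ...   | inj₂ Be = contradiction (trans (sym De) (D-intro x (cong₂ _xor_ Ae Be) x∈e Tx)) λ ()

    exposed-outside : ∀ {x} → Exposed A x → T x ≡ false → Exposed A′ x
    exposed-outside {x} Ax Tx e A′e x∈e with classify e A′e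
    ... | inj₁ (Ae , _) = Ax e Ae x∈e
    ... | inj₂ (_ , _ , e⊆T) = contradiction (trans (sym Tx) (inside-∈ᵇ T e x e⊆T x∈e)) λ ()

  insert : Fin n → VSet → VSet
  insert y S x = S x ∨ does (x ≟ y)

  vsize-insert : ∀ {y S} → S y ≡ false → vsize (insert y S) ≡ vsize S + 1
  vsize-insert {y} {S} Sy = begin
    vsize (insert y S)                ≡⟨ Σl-cong (allFin n) χ-insert ⟩
    ∑ (λ x → χ (S x) + δ x y)         ≡⟨ Σl-+ (λ x → χ (S x)) (λ x → δ x y) (allFin n) ⟩
    vsize S + ∑ (λ x → δ x y)         ≡⟨ cong (vsize S +_) (∑-δ y) ⟩
    vsize S + 1                       ∎
    where
    open ≡-Reasoning
    χ-insert : ∀ x → χ (insert y S x) ≡ χ (S x) + δ x y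
    χ-insert x with x ≟ y
    ... | yes refl rewrite Sy = refl
    ... | no  _ with S x
    ...   | true  = refl
    ...   | false = refl

  size-grow : ∀ {P Q} e → (∀ f → P f ≡ true → Q f ≡ true) → P e ≡ false → Q e ≡ true → size P + 1 ≤ size Q
  size-grow {P} {Q} e P⊆Q Pe Qe = begin
    size P + 1                       ≡⟨ cong (size P +_) (sym (∑-δ e)) ⟩
    size P + ∑ (λ f → δ f e)         ≡⟨ sym (Σl-+ (λ f → χ (P f)) (λ f → δ f e) (allFin m)) ⟩
    ∑ (λ f → χ (P f) + δ f e)        ≤⟨ Σl-mono (allFin m) pointwise ⟩
    size Q                           ∎
    where
    open ≤-Reasoning
    pointwise : ∀ f → χ (P f) + δ f e ≤ χ (Q f)
    pointwise f with f ≟ e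
    ... | yes refl rewrite Pe | Qe = ≤-refl
    ... | no  _    = ≤-trans (≤-reflexive (+-identityʳ _)) (χ-mono (P⊆Q f))

  leaving-edge : ∀ S e → S (src e) xor S (tgt e) ≡ true → Σ[ y ∈ Fin n ] (S y ≡ false × inside (insert y S) e ≡ true)
  leaving-edge S e leaves with true-or-false (S (src e)) | true-or-false (S (tgt e))
  ... | inj₂ Ss | inj₁ St = src e , Ss , cong₂ _∧_ (cong₂ _∨_ Ss (dec-true (src e ≟ src e) refl)) (cong (_∨ _) St)
  ... | inj₁ Ss | inj₂ St = tgt e , St , cong₂ _∧_ (cong (_∨ _) Ss) (cong₂ _∨_ St (dec-true (tgt e ≟ tgt e) refl))
  ... | inj₁ Ss | inj₁ St = contradiction (trans (sym leaves) (cong₂ _xor_ Ss St)) λ ()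
  ... | inj₂ Ss | inj₂ St = contradiction (trans (sym leaves) (cong₂ _xor_ Ss St)) λ ()

  -- A component-like set of H around w: it contains w, is closed under H, and has at
  -- most one vertex more than it has H-edges (as a connected subgraph would).
  Component : ESet → Fin n → Set
  Component H w = Σ[ S ∈ VSet ] (S w ≡ true × ClosedUnder H S × vsize S ≤ size (restrict H S) + 1)

  -- Grow S from {w}: while some H-edge leaves S, add its outer endpoint; this adds one
  -- vertex and at least one H-edge inside S.  The fuel bounds the number of additions.
  component : ∀ H w → Component H w
  component H w = grow n (λ x → does (x ≟ w)) (dec-true (w ≟ w) refl) (≤-trans (≤-reflexive (∑-δ w)) (m≤n+m 1 _))
                       (≤-reflexive (cong (_+ n) (sym (∑-δ w))))
    where
    grow : ∀ fuel S → S w ≡ true → vsize S ≤ size (restrict H S) + 1 → n < vsize S + fuel → Component H w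
    grow zero S Sw bound fuelOK =
      ⊥-elim (<⇒≱ (subst (n <_) (+-identityʳ (vsize S)) fuelOK) (∑-≤card (λ x → χ (S x)) (λ x → χ≤1 _)))
    grow (suc fuel) S Sw bound fuelOK with any? (λ e → (H e ∧ (S (src e) xor S (tgt e))) ≟ᵇ true)
    ... | no noneLeaves = S , Sw , closed , bound
      where
      closed : ClosedUnder H S
      closed e He with ≡-or-xor (S (src e)) (S (tgt e))
      ... | inj₁ same   = same
      ... | inj₂ leaves = ⊥-elim (noneLeaves (e , cong₂ _∧_ He leaves))
    ... | yes (e , He∧leaves) with leaving-edge S e (∧-conicalʳ (H e) _ He∧leaves)
    ...   | y , Sy , e⊆S′ = grow fuel (insert y S) (cong (_∨ _) Sw) bound′ fuelOK′
      where
      S⊆S′ : ∀ f → restrict H S f ≡ true → restrict H (insert y S) f ≡ true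
      S⊆S′ f HfS = cong₂ _∧_ (∧-conicalˡ (H f) _ HfS)
                             (inside-mono {S} {insert y S} (λ x Sx → cong (_∨ _) Sx) f (∧-conicalʳ (H f) _ HfS))
      e∉S : restrict H S e ≡ false
      e∉S = trans (cong (H e ∧_) (xor⇒∧-false (S (src e)) (S (tgt e)) (∧-conicalʳ (H e) _ He∧leaves)))
                  (∧-zeroʳ (H e))
      e∈S′ : restrict H (insert y S) e ≡ true
      e∈S′ = cong₂ _∧_ (∧-conicalˡ (H e) _ He∧leaves) e⊆S′
      bound′ : vsize (insert y S) ≤ size (restrict H (insert y S)) + 1
      bound′ = begin
        vsize (insert y S)                ≡⟨ vsize-insert Sy ⟩
        vsize S + 1                       ≤⟨ +-monoˡ-≤ 1 bound ⟩
        size (restrict H S) + 1 + 1       ≤⟨ +-monoˡ-≤ 1 (size-grow e S⊆S′ e∉S e∈S′) ⟩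
        size (restrict H (insert y S)) + 1 ∎
        where open ≤-Reasoning
      fuelOK′ : n < vsize (insert y S) + fuel
      fuelOK′ = subst (n <_) (begin
        vsize S + suc fuel         ≡⟨ +-suc (vsize S) fuel ⟩
        suc (vsize S) + fuel       ≡⟨ cong (_+ fuel) (+-comm 1 (vsize S)) ⟩
        vsize S + 1 + fuel         ≡⟨ cong (_+ fuel) (vsize-insert Sy) ⟨
        vsize (insert y S) + fuel  ∎) fuelOK
        where open ≡-Reasoning

  Adjacent : VSet → Fin n → Fin n → Set
  Adjacent X u w = Σ[ e ∈ Fin m ] (inside X e ≡ true × u ∈ᵇ e ≡ true × w ∈ᵇ e ≡ true × u ≢ w)

  data Walk (X : VSet) : Fin n → Fin n → Set where
    []  : ∀ {u} → Walk X u u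
    _∷_ : ∀ {u w v} → Adjacent X u w → Walk X w v → Walk X u v

  _++ʷ_ : ∀ {X u w v} → Walk X u w → Walk X w v → Walk X u v
  []         ++ʷ walk′ = walk′
  (uw ∷ walk) ++ʷ walk′ = uw ∷ (walk ++ʷ walk′)

  edge-walk : ∀ {X} e {a b} → a ∈ᵇ e ≡ true → b ∈ᵇ e ≡ true → X a ≡ true → X b ≡ true → Walk X a b
  edge-walk e {a} {b} a∈e b∈e Xa Xb with a ≟ b
  ... | yes refl = []
  ... | no  a≢b  = (e , inside-intro a∈e b∈e a≢b Xa Xb , a∈e , b∈e , a≢b) ∷ []

  inside-walk : ∀ {X} e {a b} → inside X e ≡ true → a ∈ᵇ e ≡ true → b ∈ᵇ e ≡ true → Walk X a b
  inside-walk {X} e {a} {b} e⊆X a∈e b∈e = edge-walk e a∈e b∈e (inside-∈ᵇ X e a e⊆X a∈e) (inside-∈ᵇ X e b e⊆X b∈e)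

  NonIsolated : VSet → Fin n → Set
  NonIsolated X x = Σ[ e ∈ Fin m ] (inside X e ≡ true × x ∈ᵇ e ≡ true)

  -- If every two edges of G are strongly adjacent, then in every induced subgraph any two
  -- non-isolated vertices u ∈ e, v ∈ f are joined by a walk: e and f share an end x, or an
  -- edge g joins an end x of e to an end y of f (and x, y lie in X, as ends of e and f).
  strongly-adjacent⇒walk : (∀ e f → StronglyAdjacent G e f) →
                           ∀ {X u v} → NonIsolated X u → NonIsolated X v → Walk X u v
  strongly-adjacent⇒walk adjacent {X} {u} {v} (e , e⊆X , u∈e) (f , f⊆X , v∈f) with adjacent e f
  ... | inj₁ (x , x∈e , x∈f) =
        inside-walk e {u} {x} e⊆X u∈e (∈ₑ⇒∈ᵇ x e x∈e) ++ʷ inside-walk f {x} {v} f⊆X (∈ₑ⇒∈ᵇ x f x∈f) v∈f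
  ... | inj₂ (g , (x , x∈g , x∈e) , (y , y∈g , y∈f)) =
        inside-walk e e⊆X u∈e x∈e′ ++ʷ
        (edge-walk g (∈ₑ⇒∈ᵇ x g x∈g) (∈ₑ⇒∈ᵇ y g y∈g) (inside-∈ᵇ X e x e⊆X x∈e′) (inside-∈ᵇ X f y f⊆X y∈f′) ++ʷ
         inside-walk f f⊆X y∈f′ v∈f)
    where
    x∈e′ : x ∈ᵇ e ≡ true
    x∈e′ = ∈ₑ⇒∈ᵇ x e x∈e
    y∈f′ : y ∈ᵇ f ≡ true
    y∈f′ = ∈ₑ⇒∈ᵇ y f y∈f

  sub-matching : ∀ {X M} D → Matching X M → Matching X (M ∩ D)
  sub-matching {M = M} D mM = record
    { within   = λ e MDe → within mM e (∧-conicalˡ (M e) _ MDe)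
    ; disjoint = λ e f x MDe MDf → disjoint mM e f x (∧-conicalˡ (M e) _ MDe) (∧-conicalˡ (M f) _ MDf) }

  -- A matching P with all edges inside S covers 2|P| vertices of S; if it also misses
  -- two distinct vertices u, v of S, then 2|P| + 2 ≤ |S|.
  matching-inside : ∀ {X P S u v} → Matching X P → (∀ e → P e ≡ true → inside S e ≡ true) →
                    u ≢ v → S u ≡ true → S v ≡ true → Exposed P u → Exposed P v → 2 * size P + 2 ≤ vsize S
  matching-inside {X} {P} {S} {u} {v} mP P⊆S u≢v Su Sv Pu Pv = begin
    2 * size P + 2                         ≡⟨ +-assoc (2 * size P) 1 1 ⟨
    2 * size P + 1 + 1                     ≡⟨ cong₂ _+_ (cong₂ _+_ (handshake P) (∑-δ u)) (∑-δ v) ⟨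
    ∑ (deg P) + ∑ (λ x → δ x u) + ∑ (λ x → δ x v)
        ≡⟨ cong (_+ ∑ (λ x → δ x v)) (Σl-+ (deg P) (λ x → δ x u) (allFin n)) ⟨
    ∑ (λ x → deg P x + δ x u) + ∑ (λ x → δ x v)
        ≡⟨ Σl-+ (λ x → deg P x + δ x u) (λ x → δ x v) (allFin n) ⟨
    ∑ (λ x → deg P x + δ x u + δ x v)      ≤⟨ Σl-mono (allFin n) pointwise ⟩
    vsize S                                ∎
    where
    open ≤-Reasoning
    outside-exposed : ∀ x → S x ≡ false → Exposed P x
    outside-exposed x Sx e Pe x∈e = contradiction (trans (sym Sx) (inside-∈ᵇ S e x (P⊆S e Pe) x∈e)) λ ()
    covered-once : ∀ x → deg P x + δ x u + δ x v ≤ 1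
    covered-once x with x ≟ u | x ≟ v
    ... | yes refl | yes u≡v  = contradiction u≡v u≢v
    ... | yes refl | no  _    = ≤-reflexive (cong (λ d → d + 1 + 0) (exposed⇒deg≡0 P u Pu))
    ... | no  _    | yes refl = ≤-reflexive (cong (λ d → d + 0 + 1) (exposed⇒deg≡0 P v Pv))
    ... | no  _    | no  _    = ≤-trans (≤-reflexive (trans (+-identityʳ _) (+-identityʳ _))) (matching-deg≤1 mP x)
    pointwise : ∀ x → deg P x + δ x u + δ x v ≤ χ (S x)
    pointwise x with true-or-false (S x)
    ... | inj₁ Sx = ≤-trans (covered-once x) (≤-reflexive (cong χ (sym Sx)))
    ... | inj₂ Sx = ≤-reflexive (trans (cong₂ _+_ (cong₂ _+_ (exposed⇒deg≡0 P x (outside-exposed x Sx))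
                      (δ-other x u (λ { refl → contradiction (trans (sym Sx) Su) λ () })))
                      (δ-other x v (λ { refl → contradiction (trans (sym Sx) Sv) λ () })))
                      (cong χ (sym Sx)))

  split-χ : ∀ a b c → χ ((a xor b) ∧ c) ≡ χ (a ∧ ((a xor b) ∧ c)) + χ (b ∧ ((a xor b) ∧ c))
  split-χ true  true  c     = refl
  split-χ true  false true  = refl
  split-χ true  false false = refl
  split-χ false true  true  = refl
  split-χ false true  false = refl
  split-χ false false c     = refl

  size-split : ∀ A B T → size (restrict (A △ B) T) ≡ size (A ∩ restrict (A △ B) T) + size (B ∩ restrict (A △ B) T)
  size-split A B T = trans (Σl-cong (allFin m) (λ e → split-χ (A e) (B e) (inside T e)))
                           (Σl-+ (λ e → χ ((A ∩ D) e)) (λ e → χ ((B ∩ D) e)) (allFin m))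
    where
    D : ESet
    D = restrict (A △ B) T

  closed-△-comm : ∀ {A B T} → ClosedUnder (A △ B) T → ClosedUnder (B △ A) T
  closed-△-comm {A} {B} closed e BAe = closed e (trans (xor-comm (A e) (B e)) BAe)

  size-△-comm : ∀ P A B T → size (P ∩ restrict (A △ B) T) ≡ size (P ∩ restrict (B △ A) T)
  size-△-comm P A B T = Σl-cong (allFin m) (λ e → cong (λ d → χ (P e ∧ (d ∧ inside T e))) (xor-comm (A e) (B e)))

  module Maximum (X : VSet) (j : ℕ) (bounded : ∀ P → Matching X P → size P ≤ j) where

    IsMaximum : ESet → Set
    IsMaximum P = Matching X P × j ≤ size P

    no-augmenting-edge : ∀ {M u w} → IsMaximum M → ∀ e → inside X e ≡ true →
                         u ∈ᵇ e ≡ true → w ∈ᵇ e ≡ true → u ≢ w → Exposed M u → Exposed M w → ⊥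
    no-augmenting-edge (mM , j≤M) e e⊆X u∈e w∈e u≢w Mu Mw with augment mM e e⊆X u∈e w∈e u≢w Mu Mw
    ... | P , mP , sizeP = <⇒≱ (s≤s j≤M) (subst (_≤ j) sizeP (bounded P mP))

    -- On a set T closed under M △ N, a maximum matching M has at least as many edges of
    -- M △ N as N has: otherwise exchanging M along T would give a larger matching.
    exchange-bound : ∀ {M N} T → IsMaximum M → Matching X N → ClosedUnder (M △ N) T →
                     size (N ∩ restrict (M △ N) T) ≤ size (M ∩ restrict (M △ N) T)
    exchange-bound {M} {N} T (mM , j≤M) mN closed = +-cancelˡ-≤ (size M) _ _ (begin
      size M + size (N ∩ D)    ≡⟨ exchange-size ⟨
      size M′ + size (M ∩ D)   ≤⟨ +-monoˡ-≤ _ (≤-trans (bounded M′ exchange-matching) j≤M) ⟩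
      size M + size (M ∩ D)    ∎)
      where
      open Exchange mM mN T closed renaming (A′ to M′)
      open ≤-Reasoning

    exchange-maximum : ∀ {M N} T → IsMaximum M → IsMaximum N → ClosedUnder (M △ N) T → IsMaximum (exchange N M T)
    exchange-maximum {M} {N} T maxM (mN , j≤N) closed = exchange-matching , ≤-trans j≤N (+-cancelʳ-≤ _ _ _ (begin
      size N + size (M ∩ D)    ≡⟨ exchange-size ⟨
      size N′ + size (N ∩ D)   ≡⟨ cong (size N′ +_) (size-△-comm N N M T) ⟩
      size N′ + size (N ∩ restrict (M △ N) T)
                               ≤⟨ +-monoʳ-≤ (size N′) (exchange-bound T maxM mN closed) ⟩
      size N′ + size (M ∩ restrict (M △ N) T)
                               ≡⟨ cong (size N′ +_) (size-△-comm M M N T) ⟩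
      size N′ + size (M ∩ D)   ∎))
      where
      open Exchange mN (proj₁ maxM) T (closed-△-comm {M} {N} {T} closed) renaming (A′ to N′)
      open ≤-Reasoning

    exchange-outside : ∀ {M N} S → IsMaximum M → IsMaximum N → ClosedUnder (M △ N) S →
                       Σ[ N′ ∈ ESet ] (IsMaximum N′ × (∀ x → Exposed M x → S x ≡ false → Exposed N′ x)
                                                    × (∀ x → Exposed N x → S x ≡ true → Exposed N′ x))
    exchange-outside {M} {N} S maxM maxN closed =
      A′ , exchange-maximum (not ∘ S) maxM maxN closedᶜ ,
      (λ x Mx Sx → exposed-inside {x} Mx (cong not Sx)) , (λ x Nx Sx → exposed-outside {x} Nx (cong not Sx))
      where
      closedᶜ : ClosedUnder (M △ N) (not ∘ S)
      closedᶜ f M△Nf = cong not (closed f M△Nf)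
      open Exchange (proj₁ maxN) (proj₁ maxM) (not ∘ S) (closed-△-comm {M} {N} {not ∘ S} closedᶜ)

    -- A set S closed under M △ N with at most one vertex more than it has M △ N edges
    -- cannot contain two vertices missed by the maximum matching M: the p edges of M in S
    -- and the two missed vertices give |S| ≥ 2p + 2, while |S| ≤ p + q + 1 with q ≤ p
    -- edges of N in S.
    component-exposed : ∀ {M N S u v} → IsMaximum M → Matching X N →
                        ClosedUnder (M △ N) S → vsize S ≤ size (restrict (M △ N) S) + 1 →
                        u ≢ v → S u ≡ true → S v ≡ true → Exposed M u → Exposed M v → ⊥
    component-exposed {M} {N} {S} {u} {v} maxM mN closed small u≢v Su Sv Mu Mv = <-irrefl refl (begin-strict
      2 * p + 1                 <⟨ +-monoʳ-< (2 * p) (n<1+n 1) ⟩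
      2 * p + 2                 ≤⟨ matching-inside (sub-matching D (proj₁ maxM)) M∩D⊆S u≢v Su Sv
                                     (λ e MDe → Mu e (∧-conicalˡ (M e) _ MDe)) (λ e MDe → Mv e (∧-conicalˡ (M e) _ MDe)) ⟩
      vsize S                   ≤⟨ small ⟩
      size D + 1                ≡⟨ cong (_+ 1) (size-split M N S) ⟩
      p + q + 1                 ≤⟨ +-monoˡ-≤ 1 (+-monoʳ-≤ p (exchange-bound S maxM mN closed)) ⟩
      p + p + 1                 ≡⟨ cong (λ t → p + t + 1) (+-identityʳ p) ⟨
      2 * p + 1                 ∎)
      where
      open ≤-Reasoning
      D : ESet
      D = restrict (M △ N) S
      p q : ℕ
      p = size (M ∩ D)
      q = size (N ∩ D)
      M∩D⊆S : ∀ e → (M ∩ D) e ≡ true → inside S e ≡ true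
      M∩D⊆S e MDe = ∧-conicalʳ ((M △ N) e) _ (∧-conicalʳ (M e) _ MDe)

    module Gallai (inessential : ∀ x → X x ≡ true → ¬ ¬ (Σ[ N ∈ ESet ] (IsMaximum N × Exposed N x))) where

      gallai : ∀ {M u v} → IsMaximum M → u ≢ v → Exposed M u → Exposed M v → Walk X u v → ⊥

      -- The walk starts with the edge e = uw, w ≠ v, and the maximum matching N misses w.
      -- Let S be the component of M △ N at w.  If u ∉ S, exchanging N towards M outside S
      -- yields a maximum matching missing both u and w; if u ∈ S but v ∉ S, it misses w
      -- and v, and we continue along the walk; if u, v ∈ S, `component-exposed` applies.
      through-component : ∀ {M N u w v} → IsMaximum M → IsMaximum N → ∀ e → inside X e ≡ true →
                          u ∈ᵇ e ≡ true → w ∈ᵇ e ≡ true → u ≢ w → w ≢ v → u ≢ v →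
                          Exposed M u → Exposed M v → Exposed N w → Walk X w v → Component (M △ N) w → ⊥
      through-component {M} {N} {u} {w} {v} maxM maxN e e⊆X u∈e w∈e u≢w w≢v u≢v Mu Mv Nw walk (S , Sw , closed , small)
        with true-or-false (S u) | true-or-false (S v) | exchange-outside S maxM maxN closed
      ... | inj₂ Su | _       | N′ , maxN′ , outsideM , insideN =
              no-augmenting-edge maxN′ e e⊆X u∈e w∈e u≢w (outsideM u Mu Su) (insideN w Nw Sw)
      ... | inj₁ Su | inj₂ Sv | N′ , maxN′ , outsideM , insideN =
              gallai maxN′ w≢v (insideN w Nw Sw) (outsideM v Mv Sv) walk
      ... | inj₁ Su | inj₁ Sv | _ = component-exposed maxM (proj₁ maxN) closed small u≢v Su Sv Mu Mv

      -- Induction along the walk u – w – … – v: if w = v the first edge augments M;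
      -- otherwise some maximum matching N misses w, and `through-component` takes over.
      gallai maxM u≢v Mu Mv [] = u≢v refl
      gallai {M} {u} {v} maxM u≢v Mu Mv (_∷_ {w = w} (e , e⊆X , u∈e , w∈e , u≢w) walk) with w ≟ v
      ... | yes refl = no-augmenting-edge maxM e e⊆X u∈e w∈e u≢w Mu Mv
      ... | no  w≢v  = inessential w (inside-∈ᵇ X e w e⊆X w∈e) λ { (N , maxN , Nw) →
                         through-component maxM maxN e e⊆X u∈e w∈e u≢w w≢v u≢v Mu Mv Nw walk (component (M △ N) w) }

  edgeList : ESet → List (Fin m)
  edgeList P = filter (λ e → P e ≟ᵇ true) (allFin m)

  edgeList-matching : ∀ {X P} → Matching X P → IsMatching G (edgeList P)
  edgeList-matching {P = P} mP =
    AllPairs-restrict noCommonEnd (all-filter (λ e → P e ≟ᵇ true) (allFin m))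
                      (AllPairs.filter⁺ (λ e → P e ≟ᵇ true) (allFin⁺ m))
    where
    noCommonEnd : ∀ {e f} → P e ≡ true → P f ≡ true → e ≢ f → ¬ Incident G e f
    noCommonEnd {e} {f} Pe Pf e≢f (x , x∈e , x∈f) = e≢f (disjoint mP e f x Pe Pf (∈ₑ⇒∈ᵇ x e x∈e) (∈ₑ⇒∈ᵇ x f x∈f))

module EdgeBound (G : Multigraph) (adjacent : ∀ e f → StronglyAdjacent G e f) where
  open Multigraph G
  open Graph G

  Δ : ℕ
  Δ = maxDegree G

  degree≤Δ : ∀ v → degree G v ≤ Δ
  degree≤Δ v = ≤-foldr-⊔ (degree G) (∈-allFin v)

  deg-inside≤Δ : ∀ X x → deg (inside X) x ≤ Δ
  deg-inside≤Δ X x = ≤-trans (Σl-mono (allFin m) (λ e → χ-mono (∧-conicalʳ (inside X e) (x ∈ᵇ e)))) (degree≤Δ x)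

  Δ≤Δ* : ∀ {k} → 1 ≤ k → Δ ≤ Δ * k
  Δ≤Δ* 1≤k = ≤-trans (≤-reflexive (sym (*-identityʳ Δ))) (*-monoʳ-≤ Δ 1≤k)

  edges : VSet → ℕ
  edges X = size (inside X)

  delete : VSet → Fin n → VSet
  delete X v x = X x ∧ not (does (v ≟ x))

  delete-matching : ∀ {X v P} → Matching (delete X v) P → Matching X P
  delete-matching {X} {v} mP = record
    { within   = λ e Pe → inside-mono {delete X v} {X} (λ x Xx → ∧-conicalˡ (X x) _ Xx) e (within mP e Pe)
    ; disjoint = disjoint mP }

  delete-exposed : ∀ {X v P} → Matching (delete X v) P → Exposed P v
  delete-exposed {X} {v} mP e Pe v∈e =
    contradiction (trans (sym (∧-zeroʳ (X v)))
                         (trans (cong (λ b → X v ∧ not b) (sym (dec-true (v ≟ v) refl)))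
                                (inside-∈ᵇ (delete X v) e v (within mP e Pe) v∈e))) λ ()

  edges-delete : ∀ X v → edges X ≤ edges (delete X v) + degree G v
  edges-delete X v = ≤-trans (Σl-mono (allFin m) pointwise)
                             (≤-reflexive (Σl-+ (λ e → χ (inside (delete X v) e)) (λ e → χ (v ∈ᵇ e)) (allFin m)))
    where
    pointwise : ∀ e → χ (inside X e) ≤ χ (inside (delete X v) e) + χ (v ∈ᵇ e)
    pointwise e with v ≟ src e | v ≟ tgt e
    ... | yes _ | _     = ≤-trans (χ≤1 _) (m≤n+m 1 _)
    ... | no  _ | yes _ = ≤-trans (χ≤1 _) (m≤n+m 1 _)
    ... | no  _ | no  _ with X (src e) | X (tgt e)
    ...   | true  | true  = ≤-refl
    ...   | true  | false = z≤n
    ...   | false | _     = z≤n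

  -- With matching number 0 there are no edges: a single edge is a matching of size 1.
  no-edges : ∀ X → (∀ P → Matching X P → size P ≤ 0) → edges X ≡ 0
  no-edges X bounded = ∑-vanish noEdge
    where
    single : ∀ e → inside X e ≡ true → Matching X (λ f → does (f ≟ e))
    single e e⊆X = record { within = within′ ; disjoint = disjoint′ }
      where
      within′ : ∀ f → does (f ≟ e) ≡ true → inside X f ≡ true
      within′ f f≡e with f ≟ e
      ... | yes refl = e⊆X
      disjoint′ : ∀ f g x → does (f ≟ e) ≡ true → does (g ≟ e) ≡ true → x ∈ᵇ f ≡ true → x ∈ᵇ g ≡ true → f ≡ g
      disjoint′ f g x f≡e g≡e _ _ with f ≟ e | g ≟ e
      ... | yes refl | yes refl = refl
    noEdge : ∀ e → χ (inside X e) ≡ 0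
    noEdge e with inside X e in e⊆X
    ... | false = refl
    ... | true  = contradiction (subst (_≤ 0) (∑-δ e) (bounded _ (single e e⊆X))) λ ()

  deletion-step : ∀ j X v → 2 * edges (delete X v) ≤ (2 * j + 1) * Δ → 2 * edges X ≤ (2 * suc j + 1) * Δ
  deletion-step j X v bound = begin
    2 * edges X                                  ≤⟨ *-monoʳ-≤ 2 (edges-delete X v) ⟩
    2 * (edges (delete X v) + degree G v)        ≡⟨ *-distribˡ-+ 2 (edges (delete X v)) (degree G v) ⟩
    2 * edges (delete X v) + 2 * degree G v      ≤⟨ +-mono-≤ bound (*-monoʳ-≤ 2 (degree≤Δ v)) ⟩
    (2 * j + 1) * Δ + 2 * Δ                      ≡⟨ step j Δ ⟩
    (2 * suc j + 1) * Δ                          ∎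
    where
    open ≤-Reasoning
    step : ∀ j Δ → (2 * j + 1) * Δ + 2 * Δ ≡ (2 * suc j + 1) * Δ
    step = solve-∀

  -- By Gallai's lemma and strong adjacency, M misses
  -- at most one non-isolated vertex; counting degrees vertex by vertex, each vertex has at
  -- most Δ edges and is covered by M or is that vertex, so 2·e(X) ≤ (2j + 1)Δ.
  module Inessential (X : VSet) (j : ℕ) (bounded : ∀ P → Matching X P → size P ≤ j) where
    open Maximum X j bounded

    module _ {M} (maxM : IsMaximum M)
             (inessential : ∀ x → X x ≡ true → ¬ ¬ (Σ[ N ∈ ESet ] (IsMaximum N × Exposed N x))) where
      open Gallai inessential

      unmatchedᵇ : ∀ x → Dec (deg M x ≡ 0) → Dec (deg (inside X) x ≡ 0) → Bool
      unmatchedᵇ x (yes _) (no _) = true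
      unmatchedᵇ x _       _      = false

      unmatched : Fin n → ℕ
      unmatched x = χ (unmatchedᵇ x (deg M x ℕ.≟ 0) (deg (inside X) x ℕ.≟ 0))

      unmatched-spec : ∀ x → 1 ≤ unmatched x → Exposed M x × NonIsolated X x
      unmatched-spec x = spec (deg M x ℕ.≟ 0) (deg (inside X) x ℕ.≟ 0)
        where
        spec : (dM : Dec (deg M x ≡ 0)) (dX : Dec (deg (inside X) x ≡ 0)) →
               1 ≤ χ (unmatchedᵇ x dM dX) → Exposed M x × NonIsolated X x
        spec (yes dM≡0) (no dX≢0) _ with Σl-positive (λ e → χ (inside X e ∧ x ∈ᵇ e)) (allFin m) (n≢0⇒n>0 dX≢0)
        ... | e , pos = deg≡0⇒exposed M x dM≡0 ,
                        e , ∧-conicalˡ (inside X e) _ (χ-true pos) , ∧-conicalʳ (inside X e) _ (χ-true pos)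
        spec (yes _) (yes _) ()
        spec (no _)  _       ()

      unmatched-atMostOne : ∑ unmatched ≤ 1
      unmatched-atMostOne = Σl-atMostOne unmatched (allFin⁺ n) (λ _ → χ≤1 _) joined
        where
        joined : ∀ x y → x ≢ y → 1 ≤ unmatched x → 1 ≤ unmatched y → ⊥
        joined x y x≢y ux uy with unmatched-spec x ux | unmatched-spec y uy
        ... | Mx , x-edge | My , y-edge = gallai maxM x≢y Mx My (strongly-adjacent⇒walk adjacent x-edge y-edge)

      degree-cover : ∀ x → deg (inside X) x ≤ Δ * (deg M x + unmatched x)
      degree-cover x = cover (deg M x ℕ.≟ 0) (deg (inside X) x ℕ.≟ 0)
        where
        cover : (dM : Dec (deg M x ≡ 0)) (dX : Dec (deg (inside X) x ≡ 0)) →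
                deg (inside X) x ≤ Δ * (deg M x + χ (unmatchedᵇ x dM dX))
        cover (no  dM≢0) _          = ≤-trans (deg-inside≤Δ X x) (Δ≤Δ* (≤-trans (n≢0⇒n>0 dM≢0) (m≤m+n _ _)))
        cover (yes _)    (yes dX≡0) = ≤-trans (≤-reflexive dX≡0) z≤n
        cover (yes _)    (no  _)    = ≤-trans (deg-inside≤Δ X x) (Δ≤Δ* (m≤n+m 1 _))

      inessential-bound : 2 * edges X ≤ (2 * j + 1) * Δ
      inessential-bound = begin
        2 * edges X                                  ≡⟨ handshake (inside X) ⟨
        ∑ (deg (inside X))                           ≤⟨ Σl-mono (allFin n) degree-cover ⟩
        ∑ (λ x → Δ * (deg M x + unmatched x))        ≡⟨ Σl-* Δ (λ x → deg M x + unmatched x) (allFin n) ⟩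
        Δ * ∑ (λ x → deg M x + unmatched x)          ≡⟨ cong (Δ *_) (Σl-+ (deg M) unmatched (allFin n)) ⟩
        Δ * (∑ (deg M) + ∑ unmatched)                ≡⟨ cong (λ d → Δ * (d + ∑ unmatched)) (handshake M) ⟩
        Δ * (2 * size M + ∑ unmatched)               ≤⟨ *-monoʳ-≤ Δ (+-mono-≤ (*-monoʳ-≤ 2 (bounded M (proj₁ maxM)))
                                                                                unmatched-atMostOne) ⟩
        Δ * (2 * j + 1)                              ≡⟨ *-comm Δ (2 * j + 1) ⟩
        (2 * j + 1) * Δ                              ∎
        where open ≤-Reasoning

  -- Some vertex v of X is essential: deleting it leaves matching number at most j
  -- (for matching number j + 1 this means v is covered by every maximum matching).
  EssentialVertex : VSet → ℕ → Set
  EssentialVertex X j = Σ[ v ∈ Fin n ] (X v ≡ true × (∀ P → Matching (delete X v) P → size P ≤ j))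

  -- If no vertex is essential, then every vertex x of X is missed by some matching of
  -- size j + 1, namely (up to double negation) by one of X − x.
  inessential-vertices : ∀ X j → ¬ EssentialVertex X j → ∀ x → X x ≡ true →
                         ¬ ¬ (Σ[ N ∈ ESet ] ((Matching X N × suc j ≤ size N) × Exposed N x))
  inessential-vertices X j noEssential x Xx noMiss = noEssential (x , Xx , λ P mP → ≤-pred (≰⇒> (λ large →
    noMiss (P , (delete-matching {X} {x} mP , large) , delete-exposed {X} {x} mP))))

  HasMatching : VSet → ℕ → Set
  HasMatching X k = Σ[ M ∈ ESet ] (Matching X M × k ≤ size M)

  -- Either X has no matching of size j + 1 (use j),
  -- or some vertex v lies in every maximum matching (delete v, use j), or no vertex
  -- does (Gallai).  These case distinctions are classical, so the bound is proved under
  -- double negation; being decidable, it is recovered at the end.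
  edge-bound : ∀ j X → (∀ P → Matching X P → size P ≤ j) → ¬ ¬ (2 * edges X ≤ (2 * j + 1) * Δ)
  edge-bound zero X bounded ¬bound = ¬bound (≤-trans (≤-reflexive (cong (2 *_) (no-edges X bounded))) z≤n)
  edge-bound (suc j) X bounded ¬bound = ¬¬-excluded-middle {A = HasMatching X (suc j)} λ where
    (no noLarge) → edge-bound j X (λ P mP → ≤-pred (≰⇒> (λ large → noLarge (P , mP , large))))
                     (λ bound → ¬bound (≤-trans bound (*-monoˡ-≤ Δ (+-monoˡ-≤ 1 (*-monoʳ-≤ 2 (n≤1+n j))))))
    (yes (M , maxM)) → ¬¬-excluded-middle {A = EssentialVertex X j} λ where
      (yes (v , Xv , boundedDel)) → edge-bound j (delete X v) boundedDel (¬bound ∘ deletion-step j X v)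
      (no noEssential) → ¬bound (Inessential.inessential-bound X (suc j) bounded {M} maxM
                                   (inessential-vertices X j noEssential))

theorem7p2 : (k : ℕ) → 5 ≤ k → (G : Multigraph) →
    (∀ (M : List (Edge G)) → IsMatching G M → length M < k) →
    (∀ (e f : Edge G) → StronglyAdjacent G e f) →
    ∀ (S : List (Edge G)) → IsStrongClique G S →
    2 * length S ≤ (2 * k ∸ 1) * maxDegree G
theorem7p2 (suc k) _ G matching<k adjacent S (distinct , _) = begin
  2 * length S                    ≤⟨ *-monoʳ-≤ 2 (distinct-length S distinct) ⟩
  2 * m                           ≡⟨ cong (2 *_) (∑-one m) ⟨
  2 * edges (λ _ → true)          ≤⟨ decidable-stable (_ ≤? _) (edge-bound k (λ _ → true) matching≤k) ⟩
  (2 * k + 1) * Δ                 ≡⟨ cong (_* Δ) (odd k) ⟩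
  (2 * suc k ∸ 1) * Δ             ∎
  where
  open Multigraph G
  open Graph G
  open EdgeBound G adjacent
  open ≤-Reasoning
  matching≤k : ∀ P → Matching (λ _ → true) P → size P ≤ k
  matching≤k P mP = ≤-pred (subst (_< suc k) (length-filter-χ P (allFin m))
                                  (matching<k (edgeList P) (edgeList-matching mP)))
  -- `2 * suc k ∸ 1` computes to `k + (suc k + 0)`
  odd : ∀ k → 2 * k + 1 ≡ k + (suc k + 0)
  odd = solve-∀
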